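{- $R_{3}(VC) > 521$. That is, there is a $3$-coloring of $[521]$ in which no two distinct integers of the same color differ by $y^3$ for any positive integer $y$.
   Context: For $n\in\mathbb{N}$, $[n]=\{1,\dots,n\}$; a $c$-coloring of $[n]$ is a function $[n]\to[c]$. For a positive integer $c$, $R_c(VC)$ (the "van der Cube" number) is the least positive integer $n$ such that every $c$-coloring of $[n]$ contains two integers $a<b$ in $[n]$ of the same color with $b-a=y^3$ for some positive integer $y$. -}

module Defs where

open import Data.Nat using (ℕ; suc; _+_; _^_; _≤_; _<_)
open import Data.Fin using (Fin)
open import Data.Product using (Σ; _×_; ∃-syntax)
open import Relation.Binary.PropositionalEquality using (_≡_)
open import Relation.Nullary using (¬_)

-- A c-coloring of [n] = {1,…,n}; represented as a function on ℕ of which only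
-- the values on 1..n matter.
Coloring : ℕ → Set
Coloring c = ℕ → Fin c

HasMonoCube : (c n : ℕ) → Coloring c → Set
HasMonoCube c n χ =
  ∃[ a ] ∃[ b ] ∃[ y ] (1 ≤ a × a < b × b ≤ n × 1 ≤ y × b ≡ a + y ^ 3 × χ a ≡ χ b)

-- "R_c(VC) > n": not every c-coloring of [n] contains a monochromatic cube
-- difference, witnessed by an explicit coloring avoiding it.
-- (Since the property is monotone in n, R_c(VC) > n iff such a coloring of [n] exists.)
RVC-> : (c n : ℕ) → Set
RVC-> c n = Σ (Coloring c) (λ χ → ¬ HasMonoCube c n χ)

{-# OPTIONS --safe #-}
module Submission where

open import Defs
open import Data.Char as Char using (Char)
open import Data.Empty using (⊥-elim)
open import Data.Fin using (Fin; zero; suc; toℕ; fromℕ<)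
open import Data.Fin.Properties using (all?; toℕ-fromℕ<; _≟_)
open import Data.List using (List; []; _∷_; concatMap)
open import Data.Nat using (ℕ; zero; suc; _+_; _^_; _≤_; _<_; _≤?_; _<?_; s≤s)
open import Data.Nat.DivMod using (_mod_)
open import Data.Nat.Properties using (≤-trans; <⇒≱; m≤m+n; m≤n+m; ^-monoˡ-≤; ≰⇒>)
open import Data.Product using (_,_)
open import Data.String using (String; toList)
open import Data.Unit using (tt)
open import Relation.Nullary using (¬_; Dec; yes; no)
open import Relation.Nullary.Decidable using (toWitness; ¬?; _→-dec_)
open import Relation.Binary.PropositionalEquality using (_≡_; subst; subst₂)

-- The coloring is given explicitly, and the absence of a monochromatic cube
-- difference is checked by evaluation: only the finitely many pairs (a, y) with
-- a + y³ ≤ n need to be inspected, and y³ ≤ n forces y < k as soon as n < k³.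

module _ {c : ℕ} (χ : Coloring c) (n : ℕ) where

  CubeStepSafe : ℕ → ℕ → Set
  CubeStepSafe a y = 1 ≤ a → 1 ≤ y → a + y ^ 3 ≤ n → ¬ χ a ≡ χ (a + y ^ 3)

  cubeStepSafe? : ∀ a y → Dec (CubeStepSafe a y)
  cubeStepSafe? a y =
    (1 ≤? a) →-dec (1 ≤? y) →-dec (a + y ^ 3 ≤? n) →-dec ¬? (χ a ≟ χ (a + y ^ 3))

cube-root-bound : ∀ {a y n k} → n < k ^ 3 → a + y ^ 3 ≤ n → y < k
cube-root-bound {a} {y} {n} {k} n<k³ a+y³≤n with k ≤? y
... | no k≰y = ≰⇒> k≰y
... | yes k≤y = ⊥-elim (<⇒≱ n<k³ k³≤n)
  where
  k³≤n : k ^ 3 ≤ n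
  k³≤n = ≤-trans (^-monoˡ-≤ 3 k≤y) (≤-trans (m≤n+m (y ^ 3) a) a+y³≤n)

cubeStepsSafe⇒¬HasMonoCube : ∀ {c n} k (χ : Coloring c) → n < k ^ 3 →
                              (∀ (a : Fin (suc n)) (y : Fin k) → CubeStepSafe χ n (toℕ a) (toℕ y)) →
                              ¬ HasMonoCube c n χ
cubeStepsSafe⇒¬HasMonoCube {n = n} k χ n<k³ safe (a , b , y , 1≤a , _ , b≤n , 1≤y , b≡a+y³ , χa≡χb) =
  safeAY 1≤a 1≤y a+y³≤n (subst (λ t → χ a ≡ χ t) b≡a+y³ χa≡χb)
  where
  a+y³≤n : a + y ^ 3 ≤ n
  a+y³≤n = subst (_≤ n) b≡a+y³ b≤n

  a<1+n : a < suc n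
  a<1+n = s≤s (≤-trans (m≤m+n a (y ^ 3)) a+y³≤n)

  y<k : y < k
  y<k = cube-root-bound n<k³ a+y³≤n

  safeAY : CubeStepSafe χ n a y
  safeAY = subst₂ (CubeStepSafe χ n) (toℕ-fromℕ< a<1+n) (toℕ-fromℕ< y<k)
                  (safe (fromℕ< a<1+n) (fromℕ< y<k))

-- ASCII 0 is 48, a multiple of 3, so reducing the code of a digit modulo 3 gives its value.
digitColor : Char → Fin 3
digitColor d = Char.toℕ d mod 3

colorAt : List Char → ℕ → Fin 3
colorAt []       _       = zero
colorAt (d ∷ _)  zero    = digitColor d
colorAt (_ ∷ ds) (suc i) = colorAt ds i

-- The i-th digit (counting from 1) is the color of i; the color of 0 is irrelevant.
coloring521 : Coloring 3
coloring521 zero    = zero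
coloring521 (suc i) = colorAt (concatMap toList digits) i
  where
  digits : List String
  digits =
    ( "010120101212012120201202010101202012120201212010120201010120"
    ∷ "121212120121202012020101201010101201012120101202012120101012"
    ∷ "120121212020120201012010101201212121201212020121202012020101"
    ∷ "212020120202010120101212012121201212121201212020120201012010"
    ∷ "121212010120201012120121202012121201202020201202010120101212"
    ∷ "012121212012120201212020120201012120201202020101201012120121"
    ∷ "212012120202012020101202010120101212020201201010121201012020"
    ∷ "121202012020202012020101201012120121202020101201010120201212"
    ∷ "01012020201201010101201012120121202012020"
    ∷ [] )

mainTheorem8 : RVC-> 3 521
mainTheorem8 =
  coloring521 ,
  cubeStepsSafe⇒¬HasMonoCube 9 coloring521
    (toWitness {a? = 521 <? 9 ^ 3} tt)
    (toWitness {a? = all? λ a → all? λ y → cubeStepSafe? coloring521 521 (toℕ a) (toℕ y)} tt)
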